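{- Let $\Sigma_4=\{0,1,2,3\}$ and let $h:\Sigma_4^*\to\Sigma_4^*$ be the morphism $h(0)=0310201023$, $h(1)=0310230102$, $h(2)=0201031023$, $h(3)=0203010201$. (a) Suppose $h(ab)=t\,h(c)\,u$ for some letters $a,b,c\in\Sigma_4$ and words $t,u\in\Sigma_4^*$. Then $t=\epsilon$, or $u=\epsilon$, or $u$ is not a prefix of $h(d)$ for any $d\in\Sigma_4$. (b) Suppose there exist letters $a,b,c\in\Sigma_4$ and words $s,t,u,v\in\Sigma_4^*$ such that $h(a)=st$, $h(b)=uv$ and $h(c)=sv$. Then $a=c$ or $b=c$.
   Context: A morphism $h:\Sigma^*\to\Delta^*$ satisfies $h(xy)=h(x)h(y)$ and is determined by its images of letters. $\epsilon$ denotes the empty word. -}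

module Defs where

open import Data.Fin using (Fin; zero; suc)
open import Data.List using (List; []; _∷_; _++_; concatMap)
open import Data.Product using (∃)
open import Relation.Binary.PropositionalEquality using (_≡_)

Σ₄ : Set
Σ₄ = Fin 4

Word : Set
Word = List Σ₄

pattern 𝟎 = zero
pattern 𝟏 = suc zero
pattern 𝟐 = suc (suc zero)
pattern 𝟑 = suc (suc (suc zero))

hL : Σ₄ → Word
hL 𝟎 = 𝟎 ∷ 𝟑 ∷ 𝟏 ∷ 𝟎 ∷ 𝟐 ∷ 𝟎 ∷ 𝟏 ∷ 𝟎 ∷ 𝟐 ∷ 𝟑 ∷ []
hL 𝟏 = 𝟎 ∷ 𝟑 ∷ 𝟏 ∷ 𝟎 ∷ 𝟐 ∷ 𝟑 ∷ 𝟎 ∷ 𝟏 ∷ 𝟎 ∷ 𝟐 ∷ []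
hL 𝟐 = 𝟎 ∷ 𝟐 ∷ 𝟎 ∷ 𝟏 ∷ 𝟎 ∷ 𝟑 ∷ 𝟏 ∷ 𝟎 ∷ 𝟐 ∷ 𝟑 ∷ []
hL 𝟑 = 𝟎 ∷ 𝟐 ∷ 𝟎 ∷ 𝟑 ∷ 𝟎 ∷ 𝟏 ∷ 𝟎 ∷ 𝟐 ∷ 𝟎 ∷ 𝟏 ∷ []

h : Word → Word
h = concatMap hL

IsPrefix : Word → Word → Set
IsPrefix u w = ∃ λ r → u ++ r ≡ w

module Submission where

open import Data.Fin.Properties using (all?) renaming (_≟_ to _≟ᶠ_)
open import Data.List using (List; []; _∷_; _++_)
open import Data.List.Properties using (∷-injective; ∷-injectiveˡ; ∷-injectiveʳ; ≡-dec)
open import Data.Product using (_×_; _,_; ∃)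
open import Data.Sum using (_⊎_)
open import Level using (Level)
open import Relation.Binary.Definitions using (DecidableEquality)
open import Relation.Binary.PropositionalEquality using (_≡_; refl; cong)
open import Relation.Nullary using (¬_; Dec; yes; no)
open import Relation.Nullary.Decidable using (map′; toWitness; _×-dec_; _⊎-dec_; _→-dec_; ¬?)

open import Defs

-- Both parts quantify only over letters and over the finitely many ways of cutting a fixed word
-- into pieces, so they are decidable propositions, settled by evaluating their decision procedures.

module _ {ℓ : Level} {A : Set ℓ} where

  ∀-splitting? : ∀ {p} {P : List A → List A → Set p} →
                 (∀ t r → Dec (P t r)) → ∀ w → Dec (∀ t r → w ≡ t ++ r → P t r)
  ∀-splitting? {P = P} P? [] = map′ at-nil (λ f → f [] [] refl) (P? [] [])
    where
    at-nil : P [] [] → ∀ t r → [] ≡ t ++ r → P t r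
    at-nil p [] [] refl = p
  ∀-splitting? {P = P} P? (x ∷ w) =
    map′ at-cons
         (λ f → f [] (x ∷ w) refl , λ t r eq → f (x ∷ t) r (cong (x ∷_) eq))
         (P? [] (x ∷ w) ×-dec ∀-splitting? (λ t → P? (x ∷ t)) w)
    where
    at-cons : P [] (x ∷ w) × (∀ t r → w ≡ t ++ r → P (x ∷ t) r) →
              ∀ t r → x ∷ w ≡ t ++ r → P t r
    at-cons (p , _) [] r refl = p
    at-cons (_ , f) (y ∷ t) r eq with refl , eq′ ← ∷-injective eq = f t r eq′

  module _ (_≟_ : DecidableEquality A) where

    ∀-infix? : ∀ {p} {P : List A → List A → Set p} →
               (∀ t u → Dec (P t u)) → ∀ m w → Dec (∀ t u → w ≡ t ++ m ++ u → P t u)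
    ∀-infix? P? m w =
      map′ (λ f t u eq → f t (m ++ u) eq m u refl refl)
           (λ g t r eq m′ u → λ { refl refl → g t u eq })
           (∀-splitting? (λ t → ∀-splitting? (λ m′ u → ≡-dec _≟_ m′ m →-dec P? t u)) w)

    isPrefix? : (u w : List A) → Dec (∃ λ r → u ++ r ≡ w)
    isPrefix? []      w       = yes (w , refl)
    isPrefix? (x ∷ u) []      = no λ ()
    isPrefix? (x ∷ u) (y ∷ w) with x ≟ y
    ... | no x≢y  = no λ (_ , eq) → x≢y (∷-injectiveˡ eq)
    ... | yes refl = map′ (λ (r , eq) → r , cong (x ∷_) eq)
                          (λ (r , eq) → r , ∷-injectiveʳ eq)
                          (isPrefix? u w)

_≟ʷ_ : DecidableEquality Word
_≟ʷ_ = ≡-dec _≟ᶠ_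

Synchronizing : Set
Synchronizing = (a b c : Σ₄) (t u : Word) → h (a ∷ b ∷ []) ≡ t ++ h (c ∷ []) ++ u →
                (t ≡ []) ⊎ (u ≡ []) ⊎ ((d : Σ₄) → ¬ IsPrefix u (h (d ∷ [])))

synchronizing? : Dec Synchronizing
synchronizing? =
  all? λ a → all? λ b → all? λ c →
  ∀-infix? _≟ᶠ_ (λ t u → (t ≟ʷ []) ⊎-dec (u ≟ʷ []) ⊎-dec
                          all? (λ d → ¬? (isPrefix? _≟ᶠ_ u (h (d ∷ [])))))
           (h (c ∷ [])) (h (a ∷ b ∷ []))

synchronizing : Synchronizing
synchronizing = toWitness {a? = synchronizing?} _

ImagesUnmixed : Set
ImagesUnmixed = (a b c : Σ₄) (s t u v : Word) →
                h (a ∷ []) ≡ s ++ t → h (b ∷ []) ≡ u ++ v → h (c ∷ []) ≡ s ++ v →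
                (a ≡ c) ⊎ (b ≡ c)

imagesUnmixed : ImagesUnmixed
imagesUnmixed a b c s t u v ha = toWitness {a? = unmixed?} _ a b c s t ha u v
  where
  unmixed? : Dec ((a b c : Σ₄) (s t : Word) → h (a ∷ []) ≡ s ++ t →
                  (u v : Word) → h (b ∷ []) ≡ u ++ v → h (c ∷ []) ≡ s ++ v → (a ≡ c) ⊎ (b ≡ c))
  unmixed? =
    all? λ a → all? λ b → all? λ c →
    ∀-splitting? (λ s t → ∀-splitting? (λ u v → (h (c ∷ []) ≟ʷ (s ++ v)) →-dec ((a ≟ᶠ c) ⊎-dec (b ≟ᶠ c)))
                                       (h (b ∷ [])))
                 (h (a ∷ []))

lemma2 : ((a b c : Σ₄) (t u : Word) → h (a ∷ b ∷ []) ≡ t ++ h (c ∷ []) ++ u →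
              (t ≡ []) ⊎ (u ≡ []) ⊎ ((d : Σ₄) → ¬ IsPrefix u (h (d ∷ []))))
           × ((a b c : Σ₄) (s t u v : Word) →
              h (a ∷ []) ≡ s ++ t → h (b ∷ []) ≡ u ++ v → h (c ∷ []) ≡ s ++ v →
              (a ≡ c) ⊎ (b ≡ c))
lemma2 = synchronizing , imagesUnmixed
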